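{- Every directed graph $G$ with $m$ edges admits a reachability-preserving DAG cover with $O(m)$ additional edges and only two DAGs.
   Context: A DAG cover of a directed graph $G$ with $f$ additional edges and $g$ DAGs is a collection $D_1,\dots,D_g$ of directed acyclic graphs, each with vertex set $V(G)$, such that $\left|\left(\bigcup_i E(D_i)\right)\setminus E(G)\right|\le f$. It is reachability-preserving if for all $s,t\in V(G)$: $s$ can reach $t$ in $G$ if and only if there exists $i$ such that $s$ can reach $t$ in $D_i$. -}

module Defs where

open import Data.Nat using (ℕ; _≤_)
open import Data.Fin using (Fin)
import Data.Fin.Properties as FinP
open import Data.Product using (_×_; _,_; ∃-syntax)
open import Data.Product.Properties using (≡-dec)
open import Data.List using (List; length; filter; deduplicate; _++_)
open import Data.List.Relation.Unary.Unique.Propositional using (Unique)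
open import Data.List.Membership.Propositional using (_∈_; _∉_)
import Data.List.Membership.DecPropositional as DecMem
open import Relation.Binary.Construct.Closure.ReflexiveTransitive using (Star)
open import Relation.Binary.Construct.Closure.Transitive using (TransClosure)
open import Relation.Binary.PropositionalEquality using (_≡_)
open import Relation.Nullary using (¬_)
open import Relation.Nullary.Decidable using (¬?)
open import Data.Sum using (_⊎_)
open import Function.Bundles using (_⇔_)

Edge : ℕ → Set
Edge n = Fin n × Fin n

_≟E_ : ∀ {n} (e f : Edge n) → Relation.Nullary.Dec (e ≡ f)
_≟E_ = ≡-dec FinP._≟_ FinP._≟_

-- A simple directed graph (self-loops allowed, no parallel edges): a duplicate-free edge list.
record Digraph (n : ℕ) : Set where
  field
    edges  : List (Edge n)
    unique : Unique edges
open Digraph public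

numEdges : ∀ {n} → Digraph n → ℕ
numEdges G = length (edges G)

Adj : ∀ {n} → List (Edge n) → Fin n → Fin n → Set
Adj E s t = (s , t) ∈ E

Reaches : ∀ {n} → List (Edge n) → Fin n → Fin n → Set
Reaches E = Star (Adj E)

Acyclic : ∀ {n} → List (Edge n) → Set
Acyclic {n} E = (v : Fin n) → ¬ TransClosure (Adj E) v v

record DAG (n : ℕ) : Set where
  field
    dedges  : List (Edge n)
    acyclic : Acyclic dedges
open DAG public

numAdditional : ∀ {n} → Digraph n → DAG n → DAG n → ℕ
numAdditional {n} G D₁ D₂ =
  length (deduplicate _≟E_
    (filter (λ e → ¬? (DecMem._∈?_ _≟E_ e (edges G))) (dedges D₁ ++ dedges D₂)))

ReachPreservingCover2 : ∀ {n} → Digraph n → ℕ → DAG n → DAG n → Set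
ReachPreservingCover2 {n} G f D₁ D₂ =
  numAdditional G D₁ D₂ ≤ f ×
  ((s t : Fin n) → Reaches (edges G) s t ⇔ (Reaches (dedges D₁) s t ⊎ Reaches (dedges D₂) s t))

-- Order the vertices by index. Inside every strongly connected component, D₁ links each vertex to
-- the next larger vertex of its component and D₂ reverses these links, so two vertices of one
-- component are joined upwards in D₁ or downwards in D₂. An edge u → x of G between different
-- components becomes the D₁-edge from the largest vertex of u's component to the smallest vertex of
-- x's; as D₁ climbs every component from its smallest to its largest vertex, it then realises all
-- reachability between different components. Each edge of D₁ or D₂ is realised by a path of G and
-- moves monotonically in index whenever it stays inside a component, so a cycle would stay in one
-- component and be monotone: both are acyclic. A vertex with a successor in its component has an
-- out-edge, so its links can be charged to its out-edges; with one cross edge per edge of G, at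
-- most 3m edges are added.
module Submission where

open import Defs
open import Data.Nat using (ℕ; _*_)
open import Data.Product using (_×_; ∃-syntax)

open import Level using (Level; 0ℓ)
import Data.Nat as ℕ
open import Data.Nat using (zero; suc; _+_; z≤n; s≤s)
import Data.Nat.Properties as ℕ
open import Data.Fin using (Fin; _≤_; _<_; _>_) renaming (zero to fzero; suc to fsuc)
open import Data.Fin.Properties using (_≟_; _<?_; ≤-antisym; ≤-total; <-irrefl; <-trans; <⇒≢; ≤∧≢⇒<)
open import Data.Fin.Induction using (>-wellFounded)
open import Data.Product using (∃; _,_; proj₁; proj₂; swap)
open import Data.Sum as Sum using (_⊎_; inj₁; inj₂)
open import Data.Empty using (⊥-elim)
open import Data.Maybe using (Maybe; just; nothing)
import Data.Maybe.Relation.Unary.All as Maybe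
import Data.Maybe.Relation.Unary.Any as Maybe
open import Data.List using (List; []; _∷_; _++_; length; mapMaybe; filter)
open import Data.List.Properties using (length-++; length-mapMaybe; length-filter; length-deduplicate)
open import Data.List.Relation.Unary.All as All using (All)
import Data.List.Relation.Unary.All.Properties as All
import Data.List.Relation.Unary.Any as Any
import Data.List.Relation.Unary.Any.Properties as Any
open import Data.List.Membership.Propositional using (_∈_)
open import Data.List.Membership.Propositional.Properties using (∈-++⁺ˡ; ∈-++⁺ʳ)
open import Induction.WellFounded using (Acc; acc)
open import Relation.Binary using (Rel; IsDecEquivalence; Transitive; Irreflexive)
open import Relation.Binary.Construct.Closure.ReflexiveTransitive as Star using (Star; ε; _◅_; _◅◅_)
open import Relation.Binary.Construct.Closure.Transitive using (TransClosure; [_]; _∷_)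
open import Relation.Binary.PropositionalEquality using (_≡_; _≢_; refl; sym; cong; subst)
open import Relation.Nullary using (Dec; yes; no; ¬_)
open import Relation.Nullary.Decidable using (_×-dec_)
open import Relation.Unary using (Pred; Decidable)
open import Function using (_∘_)
open import Function.Bundles using (mk⇔)

private variable
  ℓ : Level
  n : ℕ
  A B : Set

module _ (f : A → Maybe B) (xs : List A) where

  ∈-mapMaybe⁺ : ∀ {x y} → x ∈ xs → f x ≡ just y → y ∈ mapMaybe f xs
  ∈-mapMaybe⁺ {x} {y} x∈xs fx≡y = Any.mapMaybe⁺ f xs (Any.map⁺ (Any.map y∈f x∈xs))
    where
    y∈f : ∀ {x′} → x ≡ x′ → Maybe.Any (y ≡_) (f x′)
    y∈f refl = subst (Maybe.Any (y ≡_)) (sym fx≡y) (Maybe.just refl)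

  All-mapMaybe⁺ : ∀ {P : Pred B ℓ} → (∀ {x} → x ∈ xs → Maybe.All P (f x)) → All P (mapMaybe f xs)
  All-mapMaybe⁺ Pf = All.mapMaybe⁺ (All.map⁺ (All.tabulate Pf))

module _ {E : List (Edge n)} {a b : Fin n} where

  Reaches-∷⁻ : ∀ {s t} → Reaches ((a , b) ∷ E) s t → Reaches E s t ⊎ (Reaches E s a × Reaches E b t)
  Reaches-∷⁻ ε = inj₁ ε
  Reaches-∷⁻ (Any.here refl ◅ p) with Reaches-∷⁻ p
  ... | inj₁ b↝t       = inj₂ (ε , b↝t)
  ... | inj₂ (_ , b↝t) = inj₂ (ε , b↝t)
  Reaches-∷⁻ (Any.there e ◅ p) with Reaches-∷⁻ p
  ... | inj₁ j↝t         = inj₁ (e ◅ j↝t)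
  ... | inj₂ (j↝a , b↝t) = inj₂ (e ◅ j↝a , b↝t)

  Reaches-∷⁺ : ∀ {s t} → Reaches E s t → Reaches ((a , b) ∷ E) s t
  Reaches-∷⁺ = Star.map Any.there

reaches? : (E : List (Edge n)) (s t : Fin n) → Dec (Reaches E s t)
reaches? [] s t with s ≟ t
... | yes refl = yes ε
... | no s≢t   = no λ { ε → s≢t refl ; (() ◅ _) }
reaches? ((a , b) ∷ E) s t with reaches? E s t | reaches? E s a | reaches? E b t
... | yes s↝t | _       | _       = yes (Reaches-∷⁺ s↝t)
... | no _    | yes s↝a | yes b↝t = yes (Reaches-∷⁺ s↝a ◅◅ Any.here refl ◅ Reaches-∷⁺ b↝t)
... | no s↛t  | no s↛a  | _       = no λ p → Sum.[ s↛t , s↛a ∘ proj₁ ] (Reaches-∷⁻ p)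
... | no s↛t  | yes _   | no b↛t  = no λ p → Sum.[ s↛t , b↛t ∘ proj₂ ] (Reaches-∷⁻ p)

Minimum Maximum : Pred (Fin n) ℓ → Pred (Fin n) ℓ
Minimum P i = P i × (∀ {j} → P j → i ≤ j)
Maximum P i = P i × (∀ {j} → P j → j ≤ i)

minimum? : {P : Pred (Fin n) ℓ} → Decidable P → ∃ (Minimum P) ⊎ (∀ i → ¬ P i)
minimum? {n = zero}  P? = inj₂ λ ()
minimum? {n = suc n} P? with P? fzero | minimum? (P? ∘ fsuc)
... | yes P0 | _                    = inj₁ (fzero , P0 , λ _ → z≤n)
... | no ¬P0 | inj₁ (i , Pi , least) =
  inj₁ (fsuc i , Pi , λ { {fzero} P0 → ⊥-elim (¬P0 P0) ; {fsuc j} Pj → s≤s (least Pj) })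
... | no ¬P0 | inj₂ none            = inj₂ λ { fzero → ¬P0 ; (fsuc i) → none i }

maximum? : {P : Pred (Fin n) ℓ} → Decidable P → ∃ (Maximum P) ⊎ (∀ i → ¬ P i)
maximum? {n = zero}  P? = inj₂ λ ()
maximum? {n = suc n} P? with maximum? (P? ∘ fsuc) | P? fzero
... | inj₁ (i , Pi , greatest) | _ =
  inj₁ (fsuc i , Pi , λ { {fzero} _ → z≤n ; {fsuc j} Pj → s≤s (greatest Pj) })
... | inj₂ none | yes P0 = inj₁ (fzero , P0 , λ { {fzero} _ → z≤n ; {fsuc j} Pj → ⊥-elim (none j Pj) })
... | inj₂ none | no ¬P0 = inj₂ λ { fzero → ¬P0 ; (fsuc i) → none i }

module _ {P : Pred (Fin n) ℓ} (P? : Decidable P) {i : Fin n} (Pi : P i) where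

  minimum : ∃ (Minimum P)
  minimum = Sum.fromInj₁ (λ none → ⊥-elim (none i Pi)) (minimum? P?)

  maximum : ∃ (Maximum P)
  maximum = Sum.fromInj₁ (λ none → ⊥-elim (none i Pi)) (maximum? P?)

module ClassOrder {_~_ : Rel (Fin n) ℓ} (isDecEquivalence : IsDecEquivalence _~_) where

  open IsDecEquivalence isDecEquivalence
    using () renaming (refl to ~-refl; sym to ~-sym; trans to ~-trans; _≟_ to _~?_)

  first last : Fin n → Fin n
  first u = proj₁ (minimum (_~? u) ~-refl)
  last  u = proj₁ (maximum (_~? u) ~-refl)

  first~ : ∀ u → first u ~ u
  first~ u = proj₁ (proj₂ (minimum (_~? u) ~-refl))

  last~ : ∀ u → last u ~ u
  last~ u = proj₁ (proj₂ (maximum (_~? u) ~-refl))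

  first-minimal : ∀ {u j} → j ~ u → first u ≤ j
  first-minimal {u} = proj₂ (proj₂ (minimum (_~? u) ~-refl))

  last-maximal : ∀ {u j} → j ~ u → j ≤ last u
  last-maximal {u} = proj₂ (proj₂ (maximum (_~? u) ~-refl))

  first-cong : ∀ {u v} → u ~ v → first u ≡ first v
  first-cong {u} {v} u~v = ≤-antisym
    (first-minimal (~-trans (first~ v) (~-sym u~v)))
    (first-minimal (~-trans (first~ u) u~v))

  last-cong : ∀ {u v} → u ~ v → last u ≡ last v
  last-cong {u} {v} u~v = ≤-antisym
    (last-maximal (~-trans (last~ u) u~v))
    (last-maximal (~-trans (last~ v) (~-sym u~v)))

  Next : Rel (Fin n) ℓ
  Next u = Minimum (λ w → u < w × w ~ u)

  next? : ∀ u → ∃ (Next u) ⊎ (∀ w → ¬ (u < w × w ~ u))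
  next? u = minimum? (λ w → (u <? w) ×-dec (w ~? u))

  Next-functional : ∀ {u w w′} → Next u w → Next u w′ → w ≡ w′
  Next-functional (P , least) (P′ , least′) = ≤-antisym (least P′) (least′ P)

  ~∧≤⇒Next* : ∀ {u v} → u ~ v → u ≤ v → Star Next u v
  ~∧≤⇒Next* {u} = go (>-wellFounded u)
    where
    go : ∀ {u v} → Acc _>_ u → u ~ v → u ≤ v → Star Next u v
    go {u} {v} (acc rec) u~v u≤v with u ≟ v | next? u
    ... | yes refl | _         = ε
    ... | no u≢v   | inj₂ none = ⊥-elim (none v (≤∧≢⇒< u≤v u≢v , ~-sym u~v))
    ... | no u≢v   | inj₁ (w , next@((u<w , w~u) , least)) =
      next ◅ go (rec u<w) (~-trans w~u u~v) (least (≤∧≢⇒< u≤v u≢v , ~-sym u~v))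

  first-Next* : ∀ u → Star Next (first u) u
  first-Next* u = ~∧≤⇒Next* (first~ u) (first-minimal ~-refl)

  Next*-last : ∀ u → Star Next u (last u)
  Next*-last u = ~∧≤⇒Next* (~-sym (last~ u)) (last-maximal ~-refl)

module _ (E : List (Edge n)) {_⊏_ : Rel (Fin n) ℓ} where

  Compatible : Edge n → Set ℓ
  Compatible (a , b) = Reaches E a b × (Reaches E b a → a ⊏ b)

  module _ {L : List (Edge n)} (compatible : All Compatible L) where

    compatible⇒sound : ∀ {s t} → Reaches L s t → Reaches E s t
    compatible⇒sound ε       = ε
    compatible⇒sound (e ◅ p) = proj₁ (All.lookup compatible e) ◅◅ compatible⇒sound p

    compatible⁺ : Transitive _⊏_ → ∀ {x y} → TransClosure (Adj L) x y → Compatible (x , y)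
    compatible⁺ ⊏-trans [ e ]   = All.lookup compatible e
    compatible⁺ ⊏-trans (e ∷ p) with All.lookup compatible e | compatible⁺ ⊏-trans p
    ... | x↝a , a↝x⇒x⊏a | a↝y , y↝a⇒a⊏y =
      x↝a ◅◅ a↝y , λ y↝x → ⊏-trans (a↝x⇒x⊏a (a↝y ◅◅ y↝x)) (y↝a⇒a⊏y (y↝x ◅◅ x↝a))

    compatible⇒acyclic : Transitive _⊏_ → Irreflexive _≡_ _⊏_ → Acyclic L
    compatible⇒acyclic ⊏-trans ⊏-irrefl v cycle = ⊏-irrefl refl (proj₂ (compatible⁺ ⊏-trans cycle) ε)

numAdditional≤ : ∀ {n} (G : Digraph n) (D₁ D₂ : DAG n) →
                 numAdditional G D₁ D₂ ℕ.≤ length (dedges D₁ ++ dedges D₂)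
numAdditional≤ {n} G D₁ D₂ = ℕ.≤-trans (length-deduplicate _≟E_ (filter _ Es)) (length-filter _ Es)
  where
  Es : List (Edge n)
  Es = dedges D₁ ++ dedges D₂

∃-outEdge : ∀ {E : List (Edge n)} {u w} → Reaches E u w → u ≢ w → ∃[ x ] (u , x) ∈ E
∃-outEdge ε       u≢u = ⊥-elim (u≢u refl)
∃-outEdge (e ◅ _) _   = _ , e

module TwoDAGCover (E : List (Edge n)) where

  _⇄_ : Rel (Fin n) 0ℓ
  u ⇄ v = Reaches E u v × Reaches E v u

  _⇄?_ : ∀ u v → Dec (u ⇄ v)
  u ⇄? v = reaches? E u v ×-dec reaches? E v u

  ⇄-isDecEquivalence : IsDecEquivalence _⇄_
  ⇄-isDecEquivalence = record
    { isEquivalence = record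
      { refl  = ε , ε
      ; sym   = swap
      ; trans = λ (u↝v , v↝u) (v↝w , w↝v) → u↝v ◅◅ v↝w , w↝v ◅◅ v↝u
      }
    ; _≟_ = _⇄?_
    }

  open ClassOrder ⇄-isDecEquivalence
  open IsDecEquivalence ⇄-isDecEquivalence using () renaming (sym to ⇄-sym; trans to ⇄-trans)

  nextEdge prevEdge : Fin n → Maybe (Edge n)
  nextEdge u with next? u
  ... | inj₁ (w , _) = just (u , w)
  ... | inj₂ _       = nothing
  prevEdge u with next? u
  ... | inj₁ (w , _) = just (w , u)
  ... | inj₂ _       = nothing

  crossEdge : Edge n → Maybe (Edge n)
  crossEdge (u , x) with u ⇄? x
  ... | yes _ = nothing
  ... | no _  = just (last u , first x)

  nextEdges crossEdges E₁ E₂ : List (Edge n)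
  nextEdges  = mapMaybe (nextEdge ∘ proj₁) E
  crossEdges = mapMaybe crossEdge E
  E₁         = nextEdges ++ crossEdges
  E₂         = mapMaybe (prevEdge ∘ proj₁) E

  nextEdge-compatible : ∀ u → Maybe.All (Compatible E {_⊏_ = _<_}) (nextEdge u)
  nextEdge-compatible u with next? u
  ... | inj₁ (w , (u<w , w⇄u) , _) = Maybe.just (proj₂ w⇄u , λ _ → u<w)
  ... | inj₂ _                      = Maybe.nothing

  prevEdge-compatible : ∀ u → Maybe.All (Compatible E {_⊏_ = _>_}) (prevEdge u)
  prevEdge-compatible u with next? u
  ... | inj₁ (w , (u<w , w⇄u) , _) = Maybe.just (proj₁ w⇄u , λ _ → u<w)
  ... | inj₂ _                      = Maybe.nothing

  crossEdge-compatible : ∀ {u x} → (u , x) ∈ E → Maybe.All (Compatible E {_⊏_ = _<_}) (crossEdge (u , x))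
  crossEdge-compatible {u} {x} u→x with u ⇄? x
  ... | yes _    = Maybe.nothing
  ... | no u⇄̸x =
    Maybe.just (last↝u ◅◅ u→x ◅ x↝first , λ first↝last → ⊥-elim (u⇄̸x (u⇄x first↝last)))
    where
    last↝u : Reaches E (last u) u
    last↝u = proj₁ (last~ u)
    x↝first : Reaches E x (first x)
    x↝first = proj₂ (first~ x)
    u⇄x : Reaches E (first x) (last u) → u ⇄ x
    u⇄x first↝last = u→x ◅ ε , x↝first ◅◅ first↝last ◅◅ last↝u

  E₁-compatible : All (Compatible E {_⊏_ = _<_}) E₁
  E₁-compatible = All.++⁺
    (All-mapMaybe⁺ (nextEdge ∘ proj₁) E λ {e} _ → nextEdge-compatible (proj₁ e))
    (All-mapMaybe⁺ crossEdge E crossEdge-compatible)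

  E₂-compatible : All (Compatible E {_⊏_ = _>_}) E₂
  E₂-compatible = All-mapMaybe⁺ (prevEdge ∘ proj₁) E λ {e} _ → prevEdge-compatible (proj₁ e)

  D₁ D₂ : DAG n
  D₁ = record { dedges = E₁ ; acyclic = compatible⇒acyclic E E₁-compatible <-trans <-irrefl }
  D₂ = record
    { dedges  = E₂
    ; acyclic = compatible⇒acyclic E E₂-compatible (λ i>j j>k → <-trans j>k i>j) (<-irrefl ∘ sym)
    }

  nextEdge-Next : ∀ {u w} → Next u w → nextEdge u ≡ just (u , w)
  nextEdge-Next {u} u↦w with next? u
  ... | inj₁ (_ , u↦w′) = cong (λ w → just (u , w)) (Next-functional u↦w′ u↦w)
  ... | inj₂ none       = ⊥-elim (none _ (proj₁ u↦w))

  prevEdge-Next : ∀ {u w} → Next u w → prevEdge u ≡ just (w , u)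
  prevEdge-Next {u} u↦w with next? u
  ... | inj₁ (_ , u↦w′) = cong (λ w → just (w , u)) (Next-functional u↦w′ u↦w)
  ... | inj₂ none       = ⊥-elim (none _ (proj₁ u↦w))

  crossEdge-¬⇄ : ∀ {u x} → ¬ u ⇄ x → crossEdge (u , x) ≡ just (last u , first x)
  crossEdge-¬⇄ {u} {x} u⇄̸x with u ⇄? x
  ... | yes u⇄x = ⊥-elim (u⇄̸x u⇄x)
  ... | no _    = refl

  Next⇒outEdge : ∀ {u w} → Next u w → ∃[ x ] (u , x) ∈ E
  Next⇒outEdge ((u<w , w⇄u) , _) = ∃-outEdge (proj₂ w⇄u) (<⇒≢ u<w)

  Next⊆E₁ : ∀ {u w} → Next u w → (u , w) ∈ E₁
  Next⊆E₁ u↦w =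
    ∈-++⁺ˡ (∈-mapMaybe⁺ (nextEdge ∘ proj₁) E (proj₂ (Next⇒outEdge u↦w)) (nextEdge-Next u↦w))

  Next⊆E₂ : ∀ {u w} → Next u w → (w , u) ∈ E₂
  Next⊆E₂ u↦w = ∈-mapMaybe⁺ (prevEdge ∘ proj₁) E (proj₂ (Next⇒outEdge u↦w)) (prevEdge-Next u↦w)

  crossEdge⊆E₁ : ∀ {u x} → (u , x) ∈ E → ¬ u ⇄ x → (last u , first x) ∈ E₁
  crossEdge⊆E₁ u→x u⇄̸x = ∈-++⁺ʳ nextEdges (∈-mapMaybe⁺ crossEdge E u→x (crossEdge-¬⇄ u⇄̸x))

  Next*⇒Reaches₁ : ∀ {u v} → Star Next u v → Reaches E₁ u v
  Next*⇒Reaches₁ = Star.map Next⊆E₁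

  Next*⇒Reaches₂ : ∀ {u v} → Star Next u v → Reaches E₂ v u
  Next*⇒Reaches₂ = Star.reverse Next⊆E₂

  first↝last : ∀ u → Reaches E₁ (first u) (last u)
  first↝last u = Next*⇒Reaches₁ (first-Next* u ◅◅ Next*-last u)

  last↝first : ∀ {s t} → Reaches E s t → ¬ s ⇄ t → Reaches E₁ (last s) (first t)
  last↝first ε s⇄̸s = ⊥-elim (s⇄̸s (ε , ε))
  last↝first {s} {t} (_◅_ {j = a} s→a a↝t) s⇄̸t with s ⇄? a | a ⇄? t
  ... | yes s⇄a | _ = subst (λ z → Reaches E₁ z (first t)) (last-cong (⇄-sym s⇄a))
                        (last↝first a↝t λ a⇄t → s⇄̸t (⇄-trans s⇄a a⇄t))
  ... | no s⇄̸a | yes a⇄t = crossEdge⊆E₁ s→a s⇄̸a ◅ subst (Reaches E₁ (first a)) (first-cong a⇄t) ε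
  ... | no s⇄̸a | no a⇄̸t = crossEdge⊆E₁ s→a s⇄̸a ◅ first↝last a ◅◅ last↝first a↝t a⇄̸t

  complete : ∀ {s t} → Reaches E s t → Reaches E₁ s t ⊎ Reaches E₂ s t
  complete {s} {t} s↝t with s ⇄? t
  ... | no s⇄̸t =
    inj₁ (Next*⇒Reaches₁ (Next*-last s) ◅◅ last↝first s↝t s⇄̸t ◅◅ Next*⇒Reaches₁ (first-Next* t))
  ... | yes s⇄t with ≤-total s t
  ...   | inj₁ s≤t = inj₁ (Next*⇒Reaches₁ (~∧≤⇒Next* s⇄t s≤t))
  ...   | inj₂ t≤s = inj₂ (Next*⇒Reaches₂ (~∧≤⇒Next* (⇄-sym s⇄t) t≤s))

  length-E₁++E₂≤ : length (E₁ ++ E₂) ℕ.≤ 3 * length E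
  length-E₁++E₂≤ = begin
    length (E₁ ++ E₂)                                    ≡⟨ length-++ E₁ ⟩
    length E₁ + length E₂                                ≡⟨ cong (_+ length E₂) (length-++ nextEdges) ⟩
    (length nextEdges + length crossEdges) + length E₂   ≡⟨ ℕ.+-assoc (length nextEdges) _ _ ⟩
    length nextEdges + (length crossEdges + length E₂)   ≤⟨ ℕ.+-mono-≤ (length-mapMaybe _ E)
                                                              (ℕ.+-mono-≤ (length-mapMaybe _ E) (length-mapMaybe _ E)) ⟩
    m + (m + m)                                          ≡⟨ cong (λ k → m + (m + k)) (sym (ℕ.+-identityʳ m)) ⟩
    3 * m                                                ∎
    where
    open ℕ.≤-Reasoning
    m : ℕ
    m = length E

mainTheorem3 : ∃[ C ] ((n : ℕ) (G : Digraph n) →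
                 ∃[ D₁ ] ∃[ D₂ ] ReachPreservingCover2 G (C * numEdges G) D₁ D₂)
mainTheorem3 = 3 , λ _ G → let open TwoDAGCover (edges G) in
  D₁ , D₂ ,
  ℕ.≤-trans (numAdditional≤ G D₁ D₂) length-E₁++E₂≤ ,
  λ s t → mk⇔ complete Sum.[ compatible⇒sound (edges G) E₁-compatible
                           , compatible⇒sound (edges G) E₂-compatible ]
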